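{- Let $A$ be a poset with top element $\top$ and bottom element $\bot$. Then, for games over $A$, each left equivalence class of games has a unique maximal element with respect to $\le$ (up to equivalence $\equiv$), and these maximal elements are precisely the games that are right equivalent to $[\top]$.
   Context: Games over a poset $A$: $[a]$ atomic for $a\in A$; $\{L\mid R\}$ composite for non-empty sets $L,R$ of games (left and right options); atomic games have no options. $G\le H$ iff (1) every $G^L\triangleright H$, (2) every right option $H^R$ of $H$ has $G\triangleright H^R$, (3) if $G$ or $H$ atomic then $G\triangleright H$; $G\triangleright H$ iff (1) some $G^R\le H$, or (2) some left option $H^L$ of $H$ with $G\le H^L$, or (3) $G=[a],H=[b]$ atomic, $a\le b$. $G\equiv H$ iff $G\le H$ and $H\le G$. Left order on games: $H\le_L K$ iff for every (possibly empty) set $L$ of games and every non-empty set $R$ of games, $\{\{H\}\cup L\mid R\}\le\{\{K\}\cup L\mid R\}$. Right order: $H\le_R K$ iff for every set $R$ and every non-empty set $L$ of games, $\{L\mid R\cup\{H\}\}\le\{L\mid R\cup\{K\}\}$. $H,K$ are left equivalent if $H\le_L K$ and $K\le_L H$, and right equivalent if $H\le_R K$ and $K\le_R H$. -}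

module Defs where

open import Level using (0ℓ)
open import Data.Product using (Σ; _×_; _,_)
open import Data.Sum using (_⊎_)
open import Data.Maybe using (Maybe; just; nothing)
open import Relation.Binary.Bundles using (Poset)

-- A composite game {L | R} is given by two
-- indexed families of options, each with a chosen witness of non-emptiness.
-- (A "set of games" is represented by an indexed family; duplicates are
-- harmless since all notions below only use existence / universality over options.)
data Game (A : Set) : Set₁ where
  [_]  : A → Game A
  comp : {I J : Set} → I → (I → Game A) → J → (J → Game A) → Game A

module Games (P : Poset 0ℓ 0ℓ 0ℓ) where
  open Poset P using (Carrier) renaming (_≤_ to _⊑_)

  G : Set₁
  G = Game Carrier

  infix 4 _≤_ _▷_ _≡g_ _≤L_ _≤R_ _≈L_ _≈R_

  mutual
    -- G ≤ H : (1) every G^L ▷ H, (2) every G ▷ H^R, (3) if G or H atomic then G ▷ H.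
    _≤_ : G → G → Set
    [ a ] ≤ [ b ] = [ a ] ▷ [ b ]
    [ a ] ≤ comp j₀ HL k₀ HR = (∀ k → [ a ] ▷ HR k) × ([ a ] ▷ comp j₀ HL k₀ HR)
    comp i₀ GL k₀ GR ≤ [ b ] = (∀ i → GL i ▷ [ b ]) × (comp i₀ GL k₀ GR ▷ [ b ])
    comp i₀ GL k₀ GR ≤ comp j₀ HL l₀ HR =
      (∀ i → GL i ▷ comp j₀ HL l₀ HR) × (∀ l → comp i₀ GL k₀ GR ▷ HR l)

    -- G ▷ H : (1) some G^R ≤ H, or (2) some G ≤ H^L, or (3) G=[a], H=[b], a ≤ b.
    _▷_ : G → G → Set
    [ a ] ▷ [ b ] = a ⊑ b
    [ a ] ▷ comp {J} j₀ HL k₀ HR = Σ J (λ j → [ a ] ≤ HL j)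
    comp i₀ GL k₀ GR ▷ [ b ] = Σ _ (λ k → GR k ≤ [ b ])
    comp i₀ GL k₀ GR ▷ comp j₀ HL l₀ HR =
      Σ _ (λ k → GR k ≤ comp j₀ HL l₀ HR) ⊎ Σ _ (λ j → comp i₀ GL k₀ GR ≤ HL j)

  _≡g_ : G → G → Set
  g ≡g h = (g ≤ h) × (h ≤ g)

  withLeft : G → {I : Set} → (I → G) → {J : Set} → J → (J → G) → G
  withLeft H L r₀ R = comp nothing (λ { nothing → H ; (just i) → L i }) r₀ R

  withRight : G → {I : Set} → I → (I → G) → {J : Set} → (J → G) → G
  withRight H l₀ L R = comp l₀ L nothing (λ { nothing → H ; (just j) → R j })

  _≤L_ : G → G → Set₁
  H ≤L K = {I J : Set} (L : I → G) (r₀ : J) (R : J → G) →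
           withLeft H L r₀ R ≤ withLeft K L r₀ R

  _≤R_ : G → G → Set₁
  H ≤R K = {I J : Set} (l₀ : I) (L : I → G) (R : J → G) →
           withRight H l₀ L R ≤ withRight K l₀ L R

  _≈L_ : G → G → Set₁
  H ≈L K = (H ≤L K) × (K ≤L H)

  _≈R_ : G → G → Set₁
  H ≈R K = (H ≤R K) × (K ≤R H)

  MaximalInLeftClass : G → Set₁
  MaximalInLeftClass M = ∀ N → N ≈L M → M ≤ N → N ≤ M

-- With ⊤ and ⊥ available, ⌈ g ⌉ = {[⊤] | {g | [⊥]}} is the greatest game left-below g:
-- instantiating N ≤L g at the context {· | [⊥]} gives N ▷ {g | [⊥]}, and the left
-- option [⊤] absorbs the left options of N.  Hence M is maximal in its left class iff
-- ⌈ M ⌉ ≤ M, i.e. iff [⊤] ▷ M; and testing [⊤] ≤R M in the context {[⊤] | ·} shows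
-- that [⊤] ▷ M is the same as M ≈R [⊤].
module Submission where

open import Defs
open import Level using (0ℓ)
open import Data.Empty using (⊥; ⊥-elim)
open import Data.Unit using (⊤; tt)
open import Data.Maybe using (just; nothing)
open import Data.Product using (Σ; _×_; _,_; proj₁; proj₂)
open import Data.Sum using (inj₁; inj₂)
open import Function.Bundles using (_⇔_; mk⇔; Equivalence)
open import Function.Construct.Composition using (_⇔-∘_)
open import Relation.Binary.Bundles using (Poset)
open import Relation.Binary.Definitions using (Maximum; Minimum)

module GameOrder (P : Poset 0ℓ 0ℓ 0ℓ) where
  open Poset P using () renaming (_≤_ to _⊑_; refl to ⊑-refl; trans to ⊑-trans)
  open Games P

  ▷-viaLeft : ∀ {I J} {i₀ : I} {L : I → G} {k₀ : J} {R : J → G} (x : G) (i : I) →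
              x ≤ L i → x ▷ comp i₀ L k₀ R
  ▷-viaLeft [ a ]          i p = i , p
  ▷-viaLeft (comp _ _ _ _) i p = inj₂ (i , p)

  ▷-viaRight : ∀ {I J} {i₀ : I} {L : I → G} {k₀ : J} {R : J → G} (y : G) (k : J) →
               R k ≤ y → comp i₀ L k₀ R ▷ y
  ▷-viaRight [ b ]          k p = k , p
  ▷-viaRight (comp _ _ _ _) k p = inj₁ (k , p)

  leftOption-▷ : ∀ {I J} {i₀ : I} {L : I → G} {k₀ : J} {R : J → G} (y : G) →
                 comp i₀ L k₀ R ≤ y → ∀ i → L i ▷ y
  leftOption-▷ [ _ ]          = proj₁
  leftOption-▷ (comp _ _ _ _) = proj₁

  ≤-refl : ∀ x → x ≤ x
  ≤-refl [ a ]            = ⊑-refl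
  ≤-refl (comp _ L _ R) =
    (λ i → ▷-viaLeft (L i) i (≤-refl (L i))) , (λ k → ▷-viaRight (R k) k (≤-refl (R k)))

  mutual
    ≤-trans : ∀ x y z → x ≤ y → y ≤ z → x ≤ z
    ≤-trans [ a ] [ b ] [ c ] p q = ⊑-trans p q
    ≤-trans [ a ] [ b ] z@(comp _ _ _ zR) p q =
      (λ k → ≤-▷-trans [ a ] [ b ] (zR k) p (proj₁ q k)) , ≤-▷-trans [ a ] [ b ] z p (proj₂ q)
    ≤-trans [ a ] y@(comp _ _ _ _) [ c ] p q = ≤-▷-trans [ a ] y [ c ] p (proj₂ q)
    ≤-trans [ a ] y@(comp _ _ _ _) z@(comp _ _ _ zR) p q =
      (λ k → ≤-▷-trans [ a ] y (zR k) p (proj₂ q k)) , ▷-≤-trans [ a ] y z (proj₂ p) q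
    ≤-trans x@(comp _ xL _ _) [ b ] [ c ] p q =
      (λ i → ▷-≤-trans (xL i) [ b ] [ c ] (proj₁ p i) q) , ▷-≤-trans x [ b ] [ c ] (proj₂ p) q
    ≤-trans x@(comp _ xL _ _) [ b ] z@(comp _ _ _ zR) p q =
      (λ i → ▷-≤-trans (xL i) [ b ] z (proj₁ p i) q) , (λ l → ≤-▷-trans x [ b ] (zR l) p (proj₁ q l))
    ≤-trans x@(comp _ xL _ _) y@(comp _ _ _ _) [ c ] p q =
      (λ i → ▷-≤-trans (xL i) y [ c ] (proj₁ p i) q) , ≤-▷-trans x y [ c ] p (proj₂ q)
    ≤-trans x@(comp _ xL _ _) y@(comp _ _ _ _) z@(comp _ _ _ zR) p q =
      (λ i → ▷-≤-trans (xL i) y z (proj₁ p i) q) , (λ l → ≤-▷-trans x y (zR l) p (proj₂ q l))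

    ▷-≤-trans : ∀ x y z → x ▷ y → y ≤ z → x ▷ z
    ▷-≤-trans [ a ] [ b ] [ c ] p q = ⊑-trans p q
    ▷-≤-trans [ a ] [ b ] (comp _ zL _ _) p (_ , (j , r)) = j , ≤-trans [ a ] [ b ] (zL j) p r
    ▷-≤-trans [ a ] (comp _ yL _ _) z (j , r) q = ≤-▷-trans [ a ] (yL j) z r (leftOption-▷ z q j)
    ▷-≤-trans (comp _ _ _ xR) [ b ] z (k , r) q = ▷-viaRight z k (≤-trans (xR k) [ b ] z r q)
    ▷-≤-trans (comp _ _ _ xR) y@(comp _ _ _ _) z (inj₁ (k , r)) q =
      ▷-viaRight z k (≤-trans (xR k) y z r q)
    ▷-≤-trans x@(comp _ _ _ _) (comp _ yL _ _) z (inj₂ (j , r)) q =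
      ≤-▷-trans x (yL j) z r (leftOption-▷ z q j)

    ≤-▷-trans : ∀ x y z → x ≤ y → y ▷ z → x ▷ z
    ≤-▷-trans [ a ] [ b ] [ c ] p q = ⊑-trans p q
    ≤-▷-trans x [ b ] (comp _ zL _ _) p (j , r) = ▷-viaLeft x j (≤-trans x [ b ] (zL j) p r)
    ≤-▷-trans [ a ] (comp _ _ _ yR) [ c ] p (k , r) = ▷-≤-trans [ a ] (yR k) [ c ] (proj₁ p k) r
    ≤-▷-trans [ a ] (comp _ _ _ yR) (comp _ _ _ _) p (inj₁ (k , r)) =
      ▷-≤-trans [ a ] (yR k) _ (proj₁ p k) r
    ≤-▷-trans x y@(comp _ _ _ _) (comp _ zL _ _) p (inj₂ (j , r)) =
      ▷-viaLeft x j (≤-trans x y (zL j) p r)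
    ≤-▷-trans (comp _ _ _ xR) [ b ] [ c ] (_ , (k , r)) q = k , ≤-trans (xR k) [ b ] [ c ] r q
    ≤-▷-trans x@(comp _ _ _ _) (comp _ _ _ yR) [ c ] p (k , r) = ▷-≤-trans x (yR k) [ c ] (proj₂ p k) r
    ≤-▷-trans x@(comp _ _ _ _) (comp _ _ _ yR) (comp _ _ _ _) p (inj₁ (k , r)) =
      ▷-≤-trans x (yR k) _ (proj₂ p k) r

  ≤L-intro : ∀ {H K} → (∀ {I J} (L : I → G) (r₀ : J) (R : J → G) → H ▷ withLeft K L r₀ R) →
             H ≤L K
  ≤L-intro H▷ L r₀ R =
    (λ { nothing → H▷ L r₀ R ; (just i) → ▷-viaLeft (L i) (just i) (≤-refl (L i)) }) ,
    (λ l → ▷-viaRight (R l) l (≤-refl (R l)))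

  ≤R-intro : ∀ {H K} → (∀ {I J} (l₀ : I) (L : I → G) (R : J → G) → withRight H l₀ L R ▷ K) →
             H ≤R K
  ≤R-intro ▷K l₀ L R =
    (λ i → ▷-viaLeft (L i) i (≤-refl (L i))) ,
    (λ { nothing → ▷K l₀ L R ; (just j) → ▷-viaRight (R j) (just j) (≤-refl (R j)) })

  ≤⇒≤L : ∀ {H K} → H ≤ K → H ≤L K
  ≤⇒≤L {H} H≤K = ≤L-intro (λ L r₀ R → ▷-viaLeft H nothing H≤K)

module BoundedGameOrder (P : Poset 0ℓ 0ℓ 0ℓ) (top bot : Poset.Carrier P)
                        (top-max : Maximum (Poset._≤_ P) top)
                        (bot-min : Minimum (Poset._≤_ P) bot) where
  open Poset P using () renaming (refl to ⊑-refl)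
  open Games P
  open GameOrder P

  mutual
    ≤-top : ∀ x → x ≤ [ top ]
    ≤-top [ a ]            = top-max a
    ≤-top (comp _ L k₀ R) = (λ i → ▷-top (L i)) , (k₀ , ≤-top (R k₀))

    ▷-top : ∀ x → x ▷ [ top ]
    ▷-top [ a ]            = top-max a
    ▷-top (comp _ _ k₀ R) = k₀ , ≤-top (R k₀)

  mutual
    bot-≤ : ∀ x → [ bot ] ≤ x
    bot-≤ [ b ]            = bot-min b
    bot-≤ (comp i₀ L _ R) = (λ k → bot-▷ (R k)) , (i₀ , bot-≤ (L i₀))

    bot-▷ : ∀ x → [ bot ] ▷ x
    bot-▷ [ b ]            = bot-min b
    bot-▷ (comp i₀ L _ _) = i₀ , bot-≤ (L i₀)

  infix 9 _∣⊥ ⌈_⌉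

  _∣⊥ : G → G
  g ∣⊥ = withLeft g ⊥-elim tt (λ _ → [ bot ])

  ⌈_⌉ : G → G
  ⌈ g ⌉ = comp tt (λ _ → [ top ]) tt (λ _ → g ∣⊥)

  ∣⊥-≤ : ∀ {x} y → x ▷ y → x ∣⊥ ≤ y
  ∣⊥-≤ [ b ] x▷y = (λ { nothing → x▷y ; (just ()) }) , (tt , bot-min b)
  ∣⊥-≤ (comp _ _ _ R) x▷y =
    (λ { nothing → x▷y ; (just ()) }) , (λ l → ▷-viaRight (R l) tt (bot-≤ (R l)))

  ▷∣⊥⇒≤⌈⌉ : ∀ {g} x → x ▷ g ∣⊥ → x ≤ ⌈ g ⌉
  ▷∣⊥⇒≤⌈⌉ [ a ]            x▷ = (λ _ → x▷) , (tt , top-max a)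
  ▷∣⊥⇒≤⌈⌉ (comp _ L _ _) x▷ = (λ i → ▷-viaLeft (L i) tt (≤-top (L i))) , (λ _ → x▷)

  ≤L⇒≤⌈⌉ : ∀ {N g} → N ≤L g → N ≤ ⌈ g ⌉
  ≤L⇒≤⌈⌉ {N} N≤Lg = ▷∣⊥⇒≤⌈⌉ N (proj₁ (N≤Lg {⊥} {⊤} ⊥-elim tt (λ _ → [ bot ])) nothing)

  ≤⌈⌉ : ∀ g → g ≤ ⌈ g ⌉
  ≤⌈⌉ g = ≤L⇒≤⌈⌉ {g} {g} (≤⇒≤L (≤-refl g))

  ⌈⌉-≤L : ∀ g → ⌈ g ⌉ ≤L g
  ⌈⌉-≤L g = ≤L-intro λ L r₀ R →
    ▷-viaRight (withLeft g L r₀ R) tt (∣⊥-≤ (withLeft g L r₀ R) (▷-viaLeft g nothing (≤-refl g)))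

  ⌈⌉-≈L : ∀ g → ⌈ g ⌉ ≈L g
  ⌈⌉-≈L g = ⌈⌉-≤L g , ≤⇒≤L (≤⌈⌉ g)

  ⌈⌉-≤ : ∀ M → [ top ] ▷ M → ⌈ M ⌉ ≤ M
  ⌈⌉-≤ [ m ]          ⊤▷M = (λ _ → ⊤▷M) , (tt , ∣⊥-≤ [ m ] ⊑-refl)
  ⌈⌉-≤ (comp _ _ _ R) ⊤▷M = (λ _ → ⊤▷M) , λ l →
    ▷-viaRight (R l) tt (∣⊥-≤ (R l) (▷-viaRight (R l) l (≤-refl (R l))))

  maximal⇔top▷ : ∀ M → MaximalInLeftClass M ⇔ [ top ] ▷ M
  maximal⇔top▷ M = mk⇔
    (λ max → leftOption-▷ M (max ⌈ M ⌉ (⌈⌉-≈L M) (≤⌈⌉ M)) tt)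
    (λ ⊤▷M N (N≤LM , _) _ → ≤-trans N ⌈ M ⌉ M (≤L⇒≤⌈⌉ N≤LM) (⌈⌉-≤ M ⊤▷M))

  ⌈⌉-maximal : ∀ g → MaximalInLeftClass ⌈ g ⌉
  ⌈⌉-maximal g = from (maximal⇔top▷ ⌈ g ⌉) (tt , ⊑-refl)
    where open Equivalence

  ≤R-top : ∀ M → M ≤R [ top ]
  ≤R-top M = ≤R-intro (λ l₀ L R → ▷-top (withRight M l₀ L R))

  top▷⇒top≤R : ∀ M → [ top ] ▷ M → [ top ] ≤R M
  top▷⇒top≤R M ⊤▷M = ≤R-intro λ l₀ L R →
    ▷-≤-trans (withRight [ top ] l₀ L R) ⌈ M ⌉ M
      (▷-viaLeft (withRight [ top ] l₀ L R) tt (≤-top (withRight [ top ] l₀ L R))) (⌈⌉-≤ M ⊤▷M)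

  top≤R⇒top▷ : ∀ M → [ top ] ≤R M → [ top ] ▷ M
  top≤R⇒top▷ M ⊤≤RM =
    ≤-▷-trans [ top ] ⟨⊤∣⊤⟩ M top≤⟨⊤∣⊤⟩ (proj₂ (⊤≤RM tt (λ _ → [ top ]) ⊥-elim) nothing)
    where
    ⟨⊤∣⊤⟩ : G
    ⟨⊤∣⊤⟩ = withRight [ top ] tt (λ _ → [ top ]) ⊥-elim

    top≤⟨⊤∣⊤⟩ : [ top ] ≤ ⟨⊤∣⊤⟩
    top≤⟨⊤∣⊤⟩ = (λ { nothing → ⊑-refl ; (just ()) }) , (tt , ⊑-refl)

  top▷⇔≈Rtop : ∀ M → [ top ] ▷ M ⇔ M ≈R [ top ]
  top▷⇔≈Rtop M = mk⇔ to from
    where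
    to : [ top ] ▷ M → M ≈R [ top ]
    to ⊤▷M = ≤R-top M , top▷⇒top≤R M ⊤▷M

    from : M ≈R [ top ] → [ top ] ▷ M
    from (_ , ⊤≤RM) = top≤R⇒top▷ M ⊤≤RM

  maximal-unique : ∀ M M′ → M ≈L M′ → MaximalInLeftClass M → MaximalInLeftClass M′ → M ≡g M′
  maximal-unique M M′ (M≤LM′ , M′≤LM) max max′ =
    ≤-trans M ⌈ M′ ⌉ M′ (≤L⇒≤⌈⌉ M≤LM′) (⌈⌉-≤ M′ (to (maximal⇔top▷ M′) max′)) ,
    ≤-trans M′ ⌈ M ⌉ M (≤L⇒≤⌈⌉ M′≤LM) (⌈⌉-≤ M (to (maximal⇔top▷ M) max))
    where open Equivalence

lemma5p14 : (P : Poset 0ℓ 0ℓ 0ℓ) (top bot : Poset.Carrier P) →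
              Maximum (Poset._≤_ P) top → Minimum (Poset._≤_ P) bot →
              let open Games P in
              ((g : G) → Σ G (λ M → (M ≈L g) × MaximalInLeftClass M))
              × ((M M′ : G) → M ≈L M′ → MaximalInLeftClass M → MaximalInLeftClass M′ → M ≡g M′)
              × ((M : G) → MaximalInLeftClass M ⇔ (M ≈R [ top ]))
lemma5p14 P top bot top-max bot-min =
  (λ g → ⌈ g ⌉ , ⌈⌉-≈L g , ⌈⌉-maximal g) ,
  maximal-unique ,
  (λ M → top▷⇔≈Rtop M ⇔-∘ maximal⇔top▷ M)
  where
  open BoundedGameOrder P top bot top-max bot-min
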